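{- Let $B$ be a positive integer, let $n$ be an odd composite integer and $p$ a prime dividing $n$. There are at most $\frac{p-1}{2}$ distinct pairs $(b,c)$ of residues modulo $p$ with $\left(\frac{b^2+4c}{p}\right)=1$ such that $n$ passes the Quadratic Frobenius Test with parameters $(b,c)\bmod p$, i.e. such that $n$ passes the QFT with some parameters $(b',c')$ satisfying $(b',c')\equiv(b,c)\pmod p$.
   Context: Fix a positive integer $B$. Let $n>1$ be odd and let $b,c$ be integers with $\left(\frac{b^2+4c}{n}\right)=-1$ and $\left(\frac{ -c}{n}\right)=1$. The Quadratic Frobenius Test (QFT) with parameters $(b,c)$ on $n$, with computations in $R=(\mathbb{Z}/n\mathbb{Z})[x]/(x^2-bx-c)$: (1) if $n$ is divisible by a prime $\le\min\{B,\sqrt n\}$, declare composite and stop; (2) if $\sqrt n\in\mathbb{Z}$, declare composite and stop; (3) if $x^{(n+1)/2}\notin\mathbb{Z}/n\mathbb{Z}$ in $R$, declare composite and stop; (4) if $x^{n+1}\ne -c$ in $R$, declare composite and stop; (5) writing $n^2-1=2^rs$ with $s$ odd, if $x^s\ne1$ and $x^{2^js}\ne-1$ in $R$ for all $0\le j\le r-2$, declare composite and stop. Otherwise $n$ passes the QFT with parameters $(b,c)$. -}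

module Defs where

open import Data.Nat as ℕ using (ℕ; zero; suc; _%_; _/_)
open import Data.Nat.Primality using (Prime; Composite)
open import Data.Integer as ℤ using (ℤ; +_; _-_; -_; 0ℤ; 1ℤ; -1ℤ)
open import Data.Integer.Divisibility.Signed using (_∣?_) renaming (_∣_ to _∣ℤ_)
open import Data.Fin using (Fin; toℕ)
open import Data.Fin.Properties using (any?)
open import Data.List using (List; []; _∷_; map; foldr)
open import Data.Nat.ListAction using (product)
open import Data.Nat.Divisibility using () renaming (_∣_ to _∣ℕ_)
open import Data.List.Relation.Unary.All using (All)
open import Data.Product using (Σ; ∃; ∃-syntax; _×_; _,_; proj₁; proj₂)
open import Data.Sum using (_⊎_)
open import Relation.Nullary using (¬_; yes; no)
open import Relation.Binary.PropositionalEquality using (_≡_)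

_≡_[mod_] : ℤ → ℤ → ℕ → Set
a ≡ b [mod n ] = (+ n) ∣ℤ (a - b)

Odd : ℕ → Set
Odd n = n % 2 ≡ 1

legendre : ℤ → ℕ → ℤ
legendre a p with (+ p) ∣? a
... | yes _ = 0ℤ
... | no _ with any? {n = p} (λ (x : Fin p) → (+ p) ∣? ((+ toℕ x) ℤ.* (+ toℕ x) - a))
...   | yes _ = 1ℤ
...   | no _ = -1ℤ

productℤ : List ℤ → ℤ
productℤ = foldr ℤ._*_ 1ℤ

-- Jacobi symbol: (a / n) ≡ j  iff  writing n = p₁ ⋯ p_k as a product of
-- primes (with multiplicity), the product of the Legendre symbols
-- (a / pᵢ) equals j.  (The factorisation is unique up to order, so the
-- existential agrees with the usual definition.)
JacobiIs : ℤ → ℕ → ℤ → Set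
JacobiIs a n j = Σ (List ℕ) λ ps → All Prime ps × product ps ≡ n × productℤ (map (legendre a) ps) ≡ j

-- The ring R = (ℤ/nℤ)[x]/(x² - b x - c).  An element u + v x is
-- represented by the pair (u , v) of integer representatives.

R : Set
R = ℤ × ℤ

-- (u₁ + v₁x)(u₂ + v₂x) = u₁u₂ + c v₁v₂ + (u₁v₂ + v₁u₂ + b v₁v₂) x,
-- using x² = b x + c.
mulR : ℤ → ℤ → R → R → R
mulR b c (u₁ , v₁) (u₂ , v₂) =
  (u₁ ℤ.* u₂ ℤ.+ c ℤ.* (v₁ ℤ.* v₂)) , (u₁ ℤ.* v₂ ℤ.+ v₁ ℤ.* u₂ ℤ.+ b ℤ.* (v₁ ℤ.* v₂))

xpow : ℤ → ℤ → ℕ → R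
xpow b c zero = 1ℤ , 0ℤ
xpow b c (suc k) = mulR b c (0ℤ , 1ℤ) (xpow b c k)

_≈_[R_] : R → R → ℕ → Set
(u₁ , v₁) ≈ (u₂ , v₂) [R n ] = (u₁ ≡ u₂ [mod n ]) × (v₁ ≡ v₂ [mod n ])

-- an element lies in (the image of) ℤ/nℤ iff its x-coefficient is 0
InBase : ℕ → R → Set
InBase n (u , v) = v ≡ 0ℤ [mod n ]

-- The Quadratic Frobenius Test with bound B and parameters (b , c) on n.
-- "n passes" = the parameters are admissible (n odd, n > 1, Jacobi
-- conditions) and none of the steps (1)-(5) declares n composite.

PassesQFT : ℕ → ℕ → ℤ → ℤ → Set
PassesQFT B n b c =
    Odd n × 1 ℕ.< n
  × JacobiIs (b ℤ.* b ℤ.+ (+ 4) ℤ.* c) n -1ℤ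
  × JacobiIs (- c) n 1ℤ
  -- (1) no prime q ≤ min{B, √n} divides n   (q ≤ √n ⇔ q * q ≤ n)
  × ¬ (∃[ q ] (Prime q × q ∣ℕ n × q ℕ.≤ B × q ℕ.* q ℕ.≤ n))
  × ¬ (∃[ m ] (m ℕ.* m ≡ n))
  × InBase n (xpow b c ((n ℕ.+ 1) / 2))
  × (xpow b c (n ℕ.+ 1) ≈ (- c , 0ℤ) [R n ])
  × (∀ r s → Odd s → n ℕ.* n ℕ.∸ 1 ≡ 2 ℕ.^ r ℕ.* s →
       (xpow b c s ≈ (1ℤ , 0ℤ) [R n ])
       ⊎ (∃[ j ] (j ℕ.+ 2 ℕ.≤ r × (xpow b c (2 ℕ.^ j ℕ.* s) ≈ (-1ℤ , 0ℤ) [R n ]))))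

{-# OPTIONS --safe #-}
-- Only step (4) of the test is used: x^(n+1) = -c in R.  Reducing modulo p and evaluating
-- x at a root t of x² - b x - c gives the Frobenius relation t^(n+1) ≡ -c (mod p), which
-- survives replacing (b′, c′) by the congruent pair (b, c).  If b² + 4c is a nonzero square
-- modulo p, the quadratic has two distinct roots (b ± d)/2; the relation at both of them rules
-- out c ≡ 0, so no root is ≡ 0.  A nonzero root t determines the pair, as c ≡ -t^(n+1) and
-- b t ≡ t² - c.  So the counted pairs own pairwise disjoint two-element sets of nonzero
-- residues, and twice their number is at most p - 1.
module Submission where

open import Defs
open import Data.Nat using (ℕ; _≤_; _∸_; _/_)
open import Data.Nat.Divisibility using (_∣_)
open import Data.Nat.Primality using (Prime; Composite)
open import Data.Integer as ℤ using (ℤ; +_; 1ℤ)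
open import Data.Fin using (Fin; toℕ)
open import Data.List using (List; length)
open import Data.List.Relation.Unary.All using (All)
open import Data.List.Relation.Unary.Unique.Propositional using (Unique)
open import Data.Product using (Σ; ∃; ∃-syntax; _×_; _,_)
open import Relation.Binary.PropositionalEquality using (_≡_)

open import Data.Nat as ℕ using (zero; suc; _<_)
import Data.Nat.Properties as ℕ
import Data.Nat.DivMod as ℕ
import Data.Nat.Divisibility as ℕ
open import Data.Nat.Primality using (euclidsLemma; prime⇒nonTrivial; prime⇒nonZero)
open import Data.Integer using (-_; _+_; _-_; _*_; _^_; 0ℤ)
open import Data.Integer.DivMod using (_%ℕ_; _/ℕ_; a≡a%ℕn+[a/ℕn]*n; n%ℕd<d)
open import Data.Integer.Divisibility.Signed renaming (_∣_ to _∣ℤ_)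
open import Data.Integer.Properties
  using (abs-*; pos-+; pos-*; m-n≡m⊖n; ∣m⊝n∣≤m⊔n; ∣i∣≡0⇒i≡0; i-j≡0⇒i≡j; +-injective)
open import Data.Integer.Tactic.RingSolver using (solve-∀)
open import Data.Sum using (_⊎_; inj₁; inj₂)
open import Data.Product using (proj₁; proj₂)
import Data.Fin as Fin
open import Data.Fin.Properties using (injective⇒≤; any?; toℕ-injective; toℕ<n)
open import Data.List using ([]; _∷_; lookup; applyUpTo)
open import Data.List.Properties using (length-applyUpTo)
open import Data.List.Membership.Propositional using (_∈_)
open import Data.List.Membership.Propositional.Properties using (∈-lookup; ∈-applyUpTo⁺)
open import Data.List.Relation.Binary.Subset.Propositional using (_⊆_)
import Data.List.Relation.Unary.All as All
open import Data.List.Relation.Unary.All using ([]; _∷_)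
open import Data.List.Relation.Unary.AllPairs using ([]; _∷_)
open import Data.List.Relation.Unary.Any using (here; there; index)
open import Data.List.Relation.Unary.Any.Properties using (lookup-index)
open import Relation.Binary.PropositionalEquality as ≡ using (_≢_; subst)
open import Relation.Nullary using (¬_; contradiction; yes; no)
open import Function using (_$_; case_of_)

private variable
  m k : ℕ
  a b c d t b′ c′ t′ b₁ b₂ c₁ c₂ : ℤ

prime-∣-* : ∀ {p} → Prime p → + p ∣ℤ (a * b) → + p ∣ℤ a ⊎ + p ∣ℤ b
prime-∣-* {a} {b} {p} p-prime p∣ab
  with euclidsLemma ℤ.∣ a ∣ ℤ.∣ b ∣ p-prime (subst (p ∣_) (abs-* a b) (∣⇒∣ᵤ p∣ab))
... | inj₁ p∣a = inj₁ (∣ᵤ⇒∣ p∣a)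
... | inj₂ p∣b = inj₂ (∣ᵤ⇒∣ p∣b)

prime-∣-*-cancelʳ : ∀ {p} → Prime p → ¬ (+ p ∣ℤ b) → + p ∣ℤ (a * b) → + p ∣ℤ a
prime-∣-*-cancelʳ p-prime p∤b p∣ab with prime-∣-* p-prime p∣ab
... | inj₁ p∣a = p∣a
... | inj₂ p∣b = contradiction p∣b p∤b

prime-∣-^ : ∀ {p} → Prime p → + p ∣ℤ (a ^ k) → + p ∣ℤ a
prime-∣-^ {k = zero} p-prime p∣1 =
  contradiction (ℕ.∣1⇒≡1 (∣⇒∣ᵤ p∣1)) (ℕ.nonTrivial⇒≢1 {{prime⇒nonTrivial p-prime}})
prime-∣-^ {a = a} {k = suc k} p-prime p∣aᵏ⁺¹ with prime-∣-* {a} {a ^ k} p-prime p∣aᵏ⁺¹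
... | inj₁ p∣a  = p∣a
... | inj₂ p∣aᵏ = prime-∣-^ {a = a} {k = k} p-prime p∣aᵏ

∣-resp-mod : a ≡ b [mod m ] → + m ∣ℤ a → + m ∣ℤ b
∣-resp-mod {a} {b} a≡b m∣a = subst (_ ∣ℤ_) (identity a b) (∣m∣n⇒∣m-n m∣a a≡b)
  where
  identity : ∀ a b → a - (a - b) ≡ b
  identity = solve-∀

≡%ℕ : ∀ a m .{{_ : ℕ.NonZero m}} → a ≡ (+ (a %ℕ m)) [mod m ]
≡%ℕ a m = divides (a /ℕ m) (begin
  a - + (a %ℕ m)                            ≡⟨ ≡.cong (_- + (a %ℕ m)) (a≡a%ℕn+[a/ℕn]*n a m) ⟩
  + (a %ℕ m) + (a /ℕ m) * + m - + (a %ℕ m)  ≡⟨ identity (+ (a %ℕ m)) (a /ℕ m * + m) ⟩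
  (a /ℕ m) * + m                            ∎)
  where
  open ≡.≡-Reasoning
  identity : ∀ r x → r + x - r ≡ x
  identity = solve-∀

%ℕ-≡⇒≡ : ∀ a b m .{{_ : ℕ.NonZero m}} → a %ℕ m ≡ b %ℕ m → a ≡ b [mod m ]
%ℕ-≡⇒≡ a b m a%m≡b%m = subst (_ ∣ℤ_) (identity a b (+ (b %ℕ m)))
  (∣m∣n⇒∣m-n (subst (λ ρ → a ≡ (+ ρ) [mod m ]) a%m≡b%m (≡%ℕ a m)) (≡%ℕ b m))
  where
  identity : ∀ a b ρ → (a - ρ) - (b - ρ) ≡ a - b
  identity = solve-∀

∣∧<⇒≡0 : ∀ {n} → m ∣ n → n < m → n ≡ 0
∣∧<⇒≡0 {n = zero}  _   _   = ≡.refl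
∣∧<⇒≡0 {n = suc _} m∣n n<m = contradiction m∣n (ℕ.>⇒∤ n<m)

residue-injective : ∀ {x y} → x < m → y < m → (+ x) ≡ (+ y) [mod m ] → x ≡ y
residue-injective {m} {x} {y} x<m y<m x≡y =
  +-injective (i-j≡0⇒i≡j (+ x) (+ y) (∣i∣≡0⇒i≡0 (∣∧<⇒≡0 (∣⇒∣ᵤ x≡y) ∣x-y∣<m)))
  where
  ∣x-y∣<m : ℤ.∣ + x - + y ∣ < m
  ∣x-y∣<m = subst (_< m) (≡.cong ℤ.∣_∣ (≡.sym (m-n≡m⊖n x y)))
              (ℕ.≤-<-trans (∣m⊝n∣≤m⊔n x y) (ℕ.⊔-lub x<m y<m))

odd-∣ : ∀ {n} → m ∣ n → Odd n → Odd m
odd-∣ {m} {n} m∣n n-odd with m ℕ.% 2 in m%2≡ | ℕ.m%n<n m 2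
... | 0 | _ = contradiction (≡.trans (≡.sym (ℕ.n∣m⇒m%n≡0 n 2 2∣n)) n-odd) λ ()
  where
  2∣n : 2 ∣ n
  2∣n = ℕ.∣-trans (ℕ.m%n≡0⇒n∣m m 2 m%2≡) m∣n
... | 1 | _ = ≡.refl
... | suc (suc _) | ℕ.s≤s (ℕ.s≤s ())

-- For odd m this is (m + 1) / 2, the inverse of 2 modulo m.
half : ℕ → ℤ
half m = + (m / 2) + 1ℤ

two*half≡1 : Odd m → (+ 2 * half m) ≡ 1ℤ [mod m ]
two*half≡1 {m} m-odd = subst (+ m ∣ℤ_) (≡.sym 2h-1≡m) ∣-refl
  where
  open ≡.≡-Reasoning
  identity : ∀ q → + 2 * (q + 1ℤ) - 1ℤ ≡ 1ℤ + q * + 2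
  identity = solve-∀
  2h-1≡m : + 2 * half m - 1ℤ ≡ + m
  2h-1≡m = begin
    + 2 * half m - 1ℤ               ≡⟨ identity (+ (m / 2)) ⟩
    1ℤ + + (m / 2) * + 2            ≡⟨ ≡.cong (λ x → 1ℤ + x) (pos-* (m / 2) 2) ⟨
    1ℤ + + (m / 2 ℕ.* 2)            ≡⟨ pos-+ 1 (m / 2 ℕ.* 2) ⟨
    + (1 ℕ.+ m / 2 ℕ.* 2)           ≡⟨ ≡.cong (λ r → + (r ℕ.+ m / 2 ℕ.* 2)) m-odd ⟨
    + (m ℕ.% 2 ℕ.+ m / 2 ℕ.* 2)     ≡⟨ ≡.cong +_ (ℕ.m≡m%n+[m/n]*n m 2) ⟨
    + m                             ∎

two*[half*a]≡a : Odd m → (+ 2 * (half m * a)) ≡ a [mod m ]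
two*[half*a]≡a {m} {a} m-odd = subst (_ ∣ℤ_) (identity (half m) a) (∣m⇒∣m*n a (two*half≡1 m-odd))
  where
  identity : ∀ h a → (+ 2 * h - 1ℤ) * a ≡ + 2 * (h * a) - a
  identity = solve-∀

odd-∣two*⇒∣ : Odd m → + m ∣ℤ (+ 2 * a) → + m ∣ℤ a
odd-∣two*⇒∣ {m} {a} m-odd m∣2a = subst (_ ∣ℤ_) (identity (half m) a)
  (∣m∣n⇒∣m-n (∣n⇒∣m*n (half m) m∣2a) (∣m⇒∣m*n a (two*half≡1 m-odd)))
  where
  identity : ∀ h a → h * (+ 2 * a) - (+ 2 * h - 1ℤ) * a ≡ a
  identity = solve-∀

-- A record rather than a type synonym: the congruence unfolds to divisibility of a
-- difference, from which unification cannot recover m, b, c and t.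
record Root (m : ℕ) (b c t : ℤ) : Set where
  constructor mkRoot
  field t²≡bt+c : (t * t) ≡ (b * t + c) [mod m ]

root-from-discriminant : Odd m → (+ 2 * t) ≡ (b + d) [mod m ] →
                         (d * d) ≡ (b * b + + 4 * c) [mod m ] → Root m b c t
root-from-discriminant {m} {t} {b} {d} {c} m-odd 2t≡b+d d²≡disc =
  mkRoot (odd-∣two*⇒∣ m-odd (odd-∣two*⇒∣ m-odd (subst (_ ∣ℤ_) (identity t b c d)
    (∣m∣n⇒∣m+n (∣m⇒∣m*n (+ 2 * t - b + d) 2t≡b+d) d²≡disc))))
  where
  identity : ∀ t b c d → (+ 2 * t - (b + d)) * (+ 2 * t - b + d) + (d * d - (b * b + + 4 * c))
                         ≡ + 2 * (+ 2 * (t * t - (b * t + c)))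
  identity = solve-∀

roots-difference : Odd m → (half m * (b + d) - half m * (b - d)) ≡ d [mod m ]
roots-difference {m} {b} {d} m-odd =
  subst (_ ∣ℤ_) (identity (half m) b d) (∣m⇒∣m*n d (two*half≡1 m-odd))
  where
  identity : ∀ h b d → (+ 2 * h - 1ℤ) * d ≡ h * (b + d) - h * (b - d) - d
  identity = solve-∀

Root-resp-coefficients : b′ ≡ b [mod m ] → c′ ≡ c [mod m ] → Root m b c t → Root m b′ c′ t
Root-resp-coefficients {b′} {b} {m} {c′} {c} {t} b′≡b c′≡c (mkRoot root) = mkRoot $
  subst (_ ∣ℤ_) (identity b b′ c c′ t) (∣m∣n⇒∣m-n (∣m∣n⇒∣m-n root (∣m⇒∣m*n t b′≡b)) c′≡c)
  where
  identity : ∀ b b′ c c′ t → ((t * t - (b * t + c)) - (b′ - b) * t) - (c′ - c) ≡ t * t - (b′ * t + c′)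
  identity = solve-∀

Root-resp-≡ : t ≡ t′ [mod m ] → Root m b c t → Root m b c t′
Root-resp-≡ {t} {t′} {m} {b} {c} t≡t′ (mkRoot root) = mkRoot $
  subst (_ ∣ℤ_) (identity b c t t′) (∣m∣n⇒∣m-n root (∣m⇒∣m*n (t + t′ - b) t≡t′))
  where
  identity : ∀ b c t t′ → (t * t - (b * t + c)) - (t - t′) * (t + t′ - b) ≡ t′ * t′ - (b * t′ + c)
  identity = solve-∀

root-∣-c : Root m b c t → + m ∣ℤ t → + m ∣ℤ c
root-∣-c {m} {b} {c} {t} (mkRoot root) m∣t =
  subst (_ ∣ℤ_) (identity b c t) (∣m∣n⇒∣m-n (∣m⇒∣m*n (t - b) m∣t) root)
  where
  identity : ∀ b c t → t * (t - b) - (t * t - (b * t + c)) ≡ c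
  identity = solve-∀

-- x ↦ t, a ring homomorphism R → ℤ/mℤ whenever t is a root of x² - b x - c.
eval : ℤ → R → ℤ
eval t (u , v) = u + v * t

eval-mulR : ∀ w w′ → Root m b c t → eval t (mulR b c w w′) ≡ (eval t w * eval t w′) [mod m ]
eval-mulR {m} {b} {c} {t} (u , v) (u′ , v′) (mkRoot root) =
  subst (_ ∣ℤ_) (identity b c t u v u′ v′) (∣n⇒∣m*n (- (v * v′)) root)
  where
  identity : ∀ b c t u v u′ v′ →
    - (v * v′) * (t * t - (b * t + c))
      ≡ (u * u′ + c * (v * v′)) + (u * v′ + v * u′ + b * (v * v′)) * t - (u + v * t) * (u′ + v′ * t)
  identity = solve-∀

eval-xpow : ∀ k → Root m b c t → eval t (xpow b c k) ≡ (t ^ k) [mod m ]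
eval-xpow zero    root = divides 0ℤ ≡.refl
eval-xpow {m} {b} {c} {t} (suc k) root =
  subst (_ ∣ℤ_) (identity (eval t (xpow b c (suc k))) (eval t (xpow b c k)) t (t ^ k))
    (∣m∣n⇒∣m+n (eval-mulR (0ℤ , 1ℤ) (xpow b c k) root) (∣n⇒∣m*n t (eval-xpow k root)))
  where
  identity : ∀ e′ e t tᵏ → (e′ - (0ℤ + 1ℤ * t) * e) + t * (e - tᵏ) ≡ e′ - t * tᵏ
  identity = solve-∀

xpow-at-root : ∀ k → xpow b c k ≈ (a , 0ℤ) [R m ] → Root m b c t → (t ^ k) ≡ a [mod m ]
xpow-at-root {b} {c} {a} {m} {t} k (u≡a , v≡0) root =
  subst (_ ∣ℤ_) (identity (proj₁ (xpow b c k)) (proj₂ (xpow b c k)) a t (t ^ k))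
    (∣m∣n⇒∣m+n (∣m∣n⇒∣m+n (∣m⇒∣-m (eval-xpow k root)) u≡a) (∣m⇒∣m*n t v≡0))
  where
  identity : ∀ u v a t tᵏ → (- (u + v * t - tᵏ) + (u - a)) + (v - 0ℤ) * t ≡ tᵏ - a
  identity = solve-∀

prime-∣-base : ∀ {p} → Prime p → (t ^ k) ≡ a [mod p ] → + p ∣ℤ a → + p ∣ℤ t
prime-∣-base {t} {k} {a} p-prime tᵏ≡a p∣a =
  prime-∣-^ {a = t} {k = k} p-prime (subst (_ ∣ℤ_) (identity (t ^ k) a) (∣m∣n⇒∣m+n tᵏ≡a p∣a))
  where
  identity : ∀ tᵏ a → (tᵏ - a) + a ≡ tᵏ
  identity = solve-∀

common-root-determines-coefficients :
  ∀ {p} → Prime p → Root p b₁ c₁ t → Root p b₂ c₂ t → ¬ (+ p ∣ℤ t) →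
  (t ^ k) ≡ (- c₁) [mod p ] → (t ^ k) ≡ (- c₂) [mod p ] → b₁ ≡ b₂ [mod p ] × c₁ ≡ c₂ [mod p ]
common-root-determines-coefficients {b₁} {c₁} {t} {b₂} {c₂} {k}
  p-prime (mkRoot root₁) (mkRoot root₂) p∤t tᵏ≡-c₁ tᵏ≡-c₂ = b₁≡b₂ , c₁≡c₂
  where
  c-identity : ∀ tᵏ c₁ c₂ → (tᵏ - - c₁) - (tᵏ - - c₂) ≡ c₁ - c₂
  c-identity = solve-∀
  c₁≡c₂ : c₁ ≡ c₂ [mod _ ]
  c₁≡c₂ = subst (_ ∣ℤ_) (c-identity (t ^ k) c₁ c₂) (∣m∣n⇒∣m-n tᵏ≡-c₁ tᵏ≡-c₂)
  b-identity : ∀ b₁ c₁ b₂ c₂ t →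
    (t * t - (b₂ * t + c₂)) - (t * t - (b₁ * t + c₁)) - (c₁ - c₂) ≡ (b₁ - b₂) * t
  b-identity = solve-∀
  b₁≡b₂ : b₁ ≡ b₂ [mod _ ]
  b₁≡b₂ = prime-∣-*-cancelʳ p-prime p∤t (subst (_ ∣ℤ_) (b-identity b₁ c₁ b₂ c₂ t)
            (∣m∣n⇒∣m-n (∣m∣n⇒∣m-n root₂ root₁) c₁≡c₂))

module _ {p : ℕ} (p-prime : Prime p) (k : ℕ) where

  private instance
    p≢0 : ℕ.NonZero p
    p≢0 = prime⇒nonZero p-prime

  FrobeniusResidue : ℤ → ℤ → ℕ → Set
  FrobeniusResidue b c ρ = ρ < p × ¬ (+ p ∣ℤ + ρ) × Root p b c (+ ρ) × ((+ ρ) ^ k) ≡ (- c) [mod p ]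

  frobeniusResidue-∈ : ∀ {ρ} → FrobeniusResidue b c ρ → ρ ∈ applyUpTo suc (p ∸ 1)
  frobeniusResidue-∈ {ρ = zero}  (_ , p∤0 , _) = contradiction (divides 0ℤ ≡.refl) p∤0
  frobeniusResidue-∈ {ρ = suc ρ} (ρ<p , _)     = ∈-applyUpTo⁺ suc (ℕ.∸-monoˡ-≤ 1 ρ<p)

  two-frobenius-residues : Odd p → ¬ (+ p ∣ℤ (b * b + + 4 * c)) → (d * d) ≡ (b * b + + 4 * c) [mod p ] →
                           (∀ {t} → Root p b c t → (t ^ k) ≡ (- c) [mod p ]) →
                           ∃[ ρ₁ ] ∃[ ρ₂ ] ρ₁ ≢ ρ₂ × FrobeniusResidue b c ρ₁ × FrobeniusResidue b c ρ₂
  two-frobenius-residues {b} {c} {d} p-odd p∤disc d²≡disc frobenius =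
    r %ℕ p , s %ℕ p , residues-distinct , frobeniusResidue root-r , frobeniusResidue root-s
    where
    r s : ℤ
    r = half p * (b + d)
    s = half p * (b - d)
    root-r : Root p b c r
    root-r = root-from-discriminant p-odd (two*[half*a]≡a p-odd) d²≡disc
    d²≡[-d]² : ∀ d → d * d ≡ - d * - d
    d²≡[-d]² = solve-∀
    root-s : Root p b c s
    root-s = root-from-discriminant p-odd (two*[half*a]≡a p-odd)
               (subst (λ x → + p ∣ℤ (x - (b * b + + 4 * c))) (d²≡[-d]² d) d²≡disc)
    p∤r-s : ¬ (+ p ∣ℤ (r - s))
    p∤r-s p∣r-s = p∤disc (∣-resp-mod d²≡disc
                    (∣n⇒∣m*n d (∣-resp-mod (roots-difference {b = b} {d = d} p-odd) p∣r-s)))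
    p∤c : ¬ (+ p ∣ℤ c)
    p∤c p∣c = p∤r-s (∣m∣n⇒∣m-n (prime-∣-base {t = r} {k = k} p-prime (frobenius root-r) (∣m⇒∣-m p∣c))
                               (prime-∣-base {t = s} {k = k} p-prime (frobenius root-s) (∣m⇒∣-m p∣c)))
    frobeniusResidue : ∀ {t} → Root p b c t → FrobeniusResidue b c (t %ℕ p)
    frobeniusResidue {t} root =
      n%ℕd<d t p , (λ p∣ρ → p∤c (root-∣-c root′ p∣ρ)) , root′ , frobenius root′
      where
      root′ : Root p b c (+ (t %ℕ p))
      root′ = Root-resp-≡ (≡%ℕ t p) root
    residues-distinct : r %ℕ p ≢ s %ℕ p
    residues-distinct r%p≡s%p = p∤r-s (%ℕ-≡⇒≡ r s p r%p≡s%p)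

module _ {A : Set} where

  unique⇒lookup-injective : {xs : List A} → Unique xs → ∀ {i j} → lookup xs i ≡ lookup xs j → i ≡ j
  unique⇒lookup-injective (_ ∷ _)     {Fin.zero}  {Fin.zero}  _  = ≡.refl
  unique⇒lookup-injective (x∉xs ∷ _)  {Fin.zero}  {Fin.suc j} eq =
    contradiction eq (All.lookup x∉xs (∈-lookup j))
  unique⇒lookup-injective (x∉xs ∷ _)  {Fin.suc i} {Fin.zero}  eq =
    contradiction (≡.sym eq) (All.lookup x∉xs (∈-lookup i))
  unique⇒lookup-injective (_ ∷ xs!)   {Fin.suc i} {Fin.suc j} eq =
    ≡.cong Fin.suc (unique⇒lookup-injective xs! eq)

  unique∧⊆⇒length≤ : {xs ys : List A} → Unique xs → xs ⊆ ys → length xs ≤ length ys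
  unique∧⊆⇒length≤ {xs} {ys} xs! xs⊆ys = injective⇒≤ injective
    where
    position : Fin (length xs) → Fin (length ys)
    position i = index (xs⊆ys (∈-lookup i))
    injective : ∀ {i j} → position i ≡ position j → i ≡ j
    injective {i} {j} eq = unique⇒lookup-injective xs! (begin
      lookup xs i              ≡⟨ lookup-index (xs⊆ys (∈-lookup i)) ⟩
      lookup ys (position i)   ≡⟨ ≡.cong (lookup ys) eq ⟩
      lookup ys (position j)   ≡⟨ lookup-index (xs⊆ys (∈-lookup j)) ⟨
      lookup xs j              ∎)
      where open ≡.≡-Reasoning

module _ {A B : Set} (_▷_ : A → B → Set) where

  record TwoPartners (x : A) : Set where
    field
      first second : B
      first≢second : first ≢ second
      ▷first : x ▷ first
      ▷second : x ▷ second

  open TwoPartners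

  partners : {xs : List A} → All TwoPartners xs → List B
  partners [] = []
  partners (w ∷ ws) = first w ∷ second w ∷ partners ws

  length-partners : {xs : List A} (ws : All TwoPartners xs) → length (partners ws) ≡ length xs ℕ.* 2
  length-partners [] = ≡.refl
  length-partners (_ ∷ ws) = ≡.cong (λ l → suc (suc l)) (length-partners ws)

  ∈-partners⁻ : {xs : List A} (ws : All TwoPartners xs) → ∀ {y} → y ∈ partners ws → ∃[ x ] x ∈ xs × x ▷ y
  ∈-partners⁻ (w ∷ _)  (here ≡.refl)         = _ , here ≡.refl , ▷first w
  ∈-partners⁻ (w ∷ _)  (there (here ≡.refl)) = _ , here ≡.refl , ▷second w
  ∈-partners⁻ (_ ∷ ws) (there (there y∈))     with ∈-partners⁻ ws y∈
  ... | x , x∈ , x▷y = x , there x∈ , x▷y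

  module _ (▷-injective : ∀ {x x′ y} → x ▷ y → x′ ▷ y → x ≡ x′) where

    partners-unique : {xs : List A} → Unique xs → (ws : All TwoPartners xs) → Unique (partners ws)
    partners-unique [] [] = []
    partners-unique {x ∷ _} (x∉xs ∷ xs!) (w ∷ ws) =
      (first≢second w ∷ fresh (▷first w)) ∷ fresh (▷second w) ∷ partners-unique xs! ws
      where
      fresh : ∀ {y} → x ▷ y → All (y ≢_) (partners ws)
      fresh x▷y = All.tabulate λ {y′} y′∈ y≡y′ → case ∈-partners⁻ ws y′∈ of λ where
        (x′ , x′∈ , x′▷y′) → All.lookup x∉xs x′∈ (▷-injective x▷y (subst (x′ ▷_) (≡.sym y≡y′) x′▷y′))

    partners-length≤ : {xs : List A} {ys : List B} → (∀ {x y} → x ▷ y → y ∈ ys) →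
                       Unique xs → All TwoPartners xs → length xs ℕ.* 2 ≤ length ys
    partners-length≤ {ys = ys} ▷⇒∈ xs! ws =
      subst (_≤ length ys) (length-partners ws) (unique∧⊆⇒length≤ (partners-unique xs! ws) partners⊆ys)
      where
      partners⊆ys : partners ws ⊆ ys
      partners⊆ys y∈ = case ∈-partners⁻ ws y∈ of λ where (_ , _ , x▷y) → ▷⇒∈ x▷y

legendre≡1⇒square : ∀ {p} → legendre a p ≡ 1ℤ → ¬ (+ p ∣ℤ a) × ∃[ x ] (+ toℕ x * + toℕ x) ≡ a [mod p ]
legendre≡1⇒square {a} {p} legendre≡1 with + p ∣? a
... | yes _ = contradiction legendre≡1 λ ()
... | no p∤a with any? {n = p} (λ (x : Fin p) → + p ∣? (+ toℕ x * + toℕ x - a))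
...   | yes square = p∤a , square
...   | no _       = contradiction legendre≡1 λ ()

passesQFT⇒frobenius : ∀ {B n p} → p ∣ n → b′ ≡ b [mod p ] → c′ ≡ c [mod p ] → PassesQFT B n b′ c′ →
                      Root p b c t → (t ^ (n ℕ.+ 1)) ≡ (- c) [mod p ]
passesQFT⇒frobenius {b′} {b} {c′} {c} {t} {n = n} {p} p∣n b′≡b c′≡c
  (_ , _ , _ , _ , _ , _ , _ , (xⁿ⁺¹₀≡-c′ , xⁿ⁺¹₁≡0) , _) root =
  subst (_ ∣ℤ_) (identity (t ^ (n ℕ.+ 1)) c c′) (∣m∣n⇒∣m-n tⁿ⁺¹≡-c′ c′≡c)
  where
  mod-p : ∀ {x} → + n ∣ℤ x → + p ∣ℤ x
  mod-p = ∣-trans (∣ᵤ⇒∣ p∣n)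
  tⁿ⁺¹≡-c′ : (t ^ (n ℕ.+ 1)) ≡ (- c′) [mod p ]
  tⁿ⁺¹≡-c′ = xpow-at-root (n ℕ.+ 1) (mod-p xⁿ⁺¹₀≡-c′ , mod-p xⁿ⁺¹₁≡0)
               (Root-resp-coefficients b′≡b c′≡c root)
  identity : ∀ tⁿ⁺¹ c c′ → (tⁿ⁺¹ - - c′) - (c′ - c) ≡ tⁿ⁺¹ - - c
  identity = solve-∀

PassingSplitPair : ℕ → ℕ → (p : ℕ) → Fin p × Fin p → Set
PassingSplitPair B n p (b , c) =
  legendre (+ toℕ b ℤ.* + toℕ b ℤ.+ (+ 4) ℤ.* + toℕ c) p ≡ 1ℤ
  × ∃[ b′ ] ∃[ c′ ] (b′ ≡ + toℕ b [mod p ] × c′ ≡ + toℕ c [mod p ] × PassesQFT B n b′ c′)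

module _ {n p : ℕ} (p-prime : Prime p) (p∣n : p ∣ n) (n-odd : Odd n) where

  FrobeniusResidueOf : Fin p × Fin p → ℕ → Set
  FrobeniusResidueOf (b , c) = FrobeniusResidue p-prime (n ℕ.+ 1) (+ toℕ b) (+ toℕ c)

  frobeniusResidueOf-injective : ∀ {P P′ ρ} → FrobeniusResidueOf P ρ → FrobeniusResidueOf P′ ρ → P ≡ P′
  frobeniusResidueOf-injective {b , c} {b′ , c′} (_ , p∤ρ , root , ρⁿ⁺¹≡-c) (_ , _ , root′ , ρⁿ⁺¹≡-c′) =
    ≡.cong₂ _,_ (fin-injective (proj₁ coefficients)) (fin-injective (proj₂ coefficients))
    where
    coefficients : (+ toℕ b) ≡ (+ toℕ b′) [mod p ] × (+ toℕ c) ≡ (+ toℕ c′) [mod p ]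
    coefficients =
      common-root-determines-coefficients {k = n ℕ.+ 1} p-prime root root′ p∤ρ ρⁿ⁺¹≡-c ρⁿ⁺¹≡-c′
    fin-injective : ∀ {x y : Fin p} → (+ toℕ x) ≡ (+ toℕ y) [mod p ] → x ≡ y
    fin-injective {x} {y} x≡y = toℕ-injective (residue-injective (toℕ<n x) (toℕ<n y) x≡y)

  passingSplitPair⇒twoPartners : ∀ {B P} → PassingSplitPair B n p P → TwoPartners FrobeniusResidueOf P
  passingSplitPair⇒twoPartners {P = b , c} (legendre≡1 , b′ , c′ , b′≡b , c′≡c , passes) =
    let p∤disc , δ , δ²≡disc = legendre≡1⇒square legendre≡1
        ρ₁ , ρ₂ , ρ₁≢ρ₂ , ρ₁-residue , ρ₂-residue =
          two-frobenius-residues p-prime (n ℕ.+ 1) {d = + toℕ δ} (odd-∣ p∣n n-odd) p∤disc δ²≡disc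
            (passesQFT⇒frobenius p∣n b′≡b c′≡c passes)
    in record { first = ρ₁ ; second = ρ₂ ; first≢second = ρ₁≢ρ₂
              ; ▷first = ρ₁-residue ; ▷second = ρ₂-residue }

lemma2p8 : (B : ℕ) → 1 ≤ B → (n : ℕ) → Odd n → Composite n →
    (p : ℕ) → Prime p → p ∣ n →
    (L : List (Fin p × Fin p)) → Unique L →
    All (λ (b , c) →
           legendre (+ toℕ b ℤ.* + toℕ b ℤ.+ (+ 4) ℤ.* + toℕ c) p ≡ 1ℤ
           × ∃[ b′ ] ∃[ c′ ] (b′ ≡ + toℕ b [mod p ] × c′ ≡ + toℕ c [mod p ] × PassesQFT B n b′ c′)) L →
    length L ≤ (p ∸ 1) / 2
lemma2p8 B _ n n-odd _ p p-prime p∣n L L! passing = begin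
  length L                ≡⟨ ℕ.m*n/n≡m (length L) 2 ⟨
  length L ℕ.* 2 / 2      ≤⟨ ℕ./-monoˡ-≤ 2 twice-length≤ ⟩
  (p ∸ 1) / 2             ∎
  where
  open ℕ.≤-Reasoning
  twice-length≤ : length L ℕ.* 2 ≤ p ∸ 1
  twice-length≤ = subst (length L ℕ.* 2 ≤_) (length-applyUpTo suc (p ∸ 1))
    (partners-length≤ (FrobeniusResidueOf p-prime p∣n n-odd)
      (frobeniusResidueOf-injective p-prime p∣n n-odd)
      (frobeniusResidue-∈ p-prime (n ℕ.+ 1)) L!
      (All.map (passingSplitPair⇒twoPartners p-prime p∣n n-odd) passing))
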